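{- Let $\Delta$ be a bi-transitive bipartite digraph satisfying properties N1 and N4. Let $u$ and $v$ be two independent vertices of $\Delta$ with no common out-neighbour. Then for any vertex $w$, $u$ and $v$ are not both strongly connected to $w$.
   Context: Digraphs have no loops or multiple edges; $N(x)$ is the set of out-neighbours of $x$, $N(S)=\bigcup_{s\in S}N(s)$. A bipartite digraph has two colour classes with every edge joining different classes; it is bi-transitive if whenever $u_1v_1,v_1u_2,u_2v_2$ are edges, $u_1v_2$ is an edge. Vertices $x,y$ are independent if neither $xy$ nor $yx$ is an edge. N1: for any two independent vertices $x,y$, $N(x)\cap N(N(y))=N(y)\cap N(N(x))=\emptyset$. N4: every vertex has at least one out-neighbour. A vertex $x$ is strongly connected to $y$ if there is a directed walk $x=x_0\to\cdots\to x_k=y$ with $k\ge1$. -}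

module Defs where

open import Level using (Level; _⊔_; suc)
open import Data.Bool using (Bool)
open import Data.Product using (Σ; ∃; _×_; _,_)
open import Relation.Nullary using (¬_)
open import Relation.Binary.PropositionalEquality using (_≡_; _≢_)

-- A digraph: a vertex type with an irreflexive edge relation
-- (a relation has no multiple edges by construction).
record Digraph (a ℓ : Level) : Set (suc (a ⊔ ℓ)) where
  field
    V    : Set a
    E    : V → V → Set ℓ
    loopless : ∀ x → ¬ E x x

module _ {a ℓ} (Δ : Digraph a ℓ) where
  open Digraph Δ

  _∈N_ : V → V → Set ℓ
  y ∈N x = E x y

  _∈NN_ : V → V → Set (a ⊔ ℓ)
  y ∈NN x = ∃ λ z → E x z × E z y

  IsBipartite : Set (a ⊔ ℓ)
  IsBipartite = Σ (V → Bool) λ col → ∀ x y → E x y → col x ≢ col y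

  IsBiTransitive : Set (a ⊔ ℓ)
  IsBiTransitive = ∀ u₁ v₁ u₂ v₂ → E u₁ v₁ → E v₁ u₂ → E u₂ v₂ → E u₁ v₂

  Independent : V → V → Set ℓ
  Independent x y = ¬ E x y × ¬ E y x

  N1 : Set (a ⊔ ℓ)
  N1 = ∀ x y → Independent x y →
         (∀ z → ¬ (z ∈N x × z ∈NN y)) × (∀ z → ¬ (z ∈N y × z ∈NN x))

  N4 : Set (a ⊔ ℓ)
  N4 = ∀ x → ∃ λ y → E x y

  data StronglyConnected : V → V → Set (a ⊔ ℓ) where
    step : ∀ {x y} → E x y → StronglyConnected x y
    _∷_  : ∀ {x y z} → E x y → StronglyConnected y z → StronglyConnected x z

  NoCommonOutNeighbour : V → V → Set (a ⊔ ℓ)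
  NoCommonOutNeighbour u v = ∀ z → ¬ (E u z × E v z)

module Submission where

open import Defs
open import Data.Product using (_×_; _,_; proj₁; proj₂; ∃)
open import Data.Sum using (_⊎_; inj₁; inj₂)
open import Relation.Nullary using (¬_)

-- Bi-transitivity shortcuts every walk to length one or two, which N1 and the
-- absence of common out-neighbours rule out in all combinations but two walks of
-- length two; those are extended by an out-neighbour of w (N4) and shortcut again,
-- producing a common out-neighbour of u and v.

module _ {a ℓ} (Δ : Digraph a ℓ) (biTransitive : IsBiTransitive Δ) where
  open Digraph Δ

  stronglyConnected⇒edge⊎path₂ : ∀ {x y} → StronglyConnected Δ x y →
                                 E x y ⊎ (∃ λ z → E x z × E z y)
  stronglyConnected⇒edge⊎path₂ (step xy) = inj₁ xy
  stronglyConnected⇒edge⊎path₂ (xy ∷ walk) with stronglyConnected⇒edge⊎path₂ walk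
  ... | inj₁ yz            = inj₂ (_ , xy , yz)
  ... | inj₂ (_ , ym , mz) = inj₁ (biTransitive _ _ _ _ xy ym mz)

  path₂-extend : ∀ {x y z} → (∃ λ m → E x m × E m y) → E y z → E x z
  path₂-extend (_ , xm , my) yz = biTransitive _ _ _ _ xm my yz

proposition3 : ∀ {a ℓ} (Δ : Digraph a ℓ) → IsBipartite Δ → IsBiTransitive Δ → N1 Δ → N4 Δ → (u v : Digraph.V Δ) → Independent Δ u v → NoCommonOutNeighbour Δ u v → (w : Digraph.V Δ) → ¬ (StronglyConnected Δ u w × StronglyConnected Δ v w)
proposition3 Δ _ biTransitive n1 n4 u v independent noCommon w (uw , vw)
  with stronglyConnected⇒edge⊎path₂ Δ biTransitive uw
     | stronglyConnected⇒edge⊎path₂ Δ biTransitive vw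
... | inj₁ uw₁ | inj₁ vw₁ = noCommon w (uw₁ , vw₁)
... | inj₁ uw₁ | inj₂ vw₂ = proj₁ (n1 u v independent) w (uw₁ , vw₂)
... | inj₂ uw₂ | inj₁ vw₁ = proj₂ (n1 u v independent) w (vw₁ , uw₂)
... | inj₂ uw₂ | inj₂ vw₂ with n4 w
...   | c , wc = noCommon c (path₂-extend Δ biTransitive uw₂ wc , path₂-extend Δ biTransitive vw₂ wc)
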